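{- Let $r\geq 2$ and $n\geq\max\{8,2r+1\}$, and let $h:\Omega_S\to\Omega_F$ be the chaining map. Then $\max_{G\in\Omega_F}|h^{ -1}(G)|\leq 2rn$.
   Context: $\Omega_S$ is the set of all $2r$-regular simple graphs on vertex set $[n]=\{1,\dots,n\}$ and $\Omega_F$ the subset of connected ones. The chaining map $h$ is defined as follows. Given $G_S\in\Omega_S$ with components $H_1,\dots,H_k$, let $v_i$ be the highest-labelled vertex of $H_i$, with components indexed so that $v_1<v_2<\dots<v_k$, and let $v_i'$ be the highest-labelled neighbour of $v_i$. Then $h(G_S)$ is obtained from $G_S$ by deleting the edges $v_iv_i'$ for $i=1,\dots,k$ and adding the edges $v_i'v_{i+1}$ for $i=1,\dots,k$, with cyclic indices ($v_{k+1}=v_1$). This map takes values in $\Omega_F$. -}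

module Defs where

open import Data.Nat using (ℕ; zero; suc; _*_; _+_; _<?_)
open import Data.Bool using (Bool; true; false; if_then_else_)
open import Data.Fin using (Fin; toℕ; fromℕ<) renaming (zero to fzero; suc to fsuc; _≤_ to _≤ᶠ_; _<_ to _<ᶠ_)
open import Data.Vec using (Vec; lookup; map; sum)
open import Data.Product using (_×_; Σ; ∃; _,_)
open import Data.Sum using (_⊎_)
open import Relation.Nullary using (¬_; yes; no)
open import Relation.Binary.PropositionalEquality using (_≡_)
open import Function.Bundles using (_⇔_)

Graph : ℕ → Set
Graph n = Vec (Vec Bool n) n

adj : ∀ {n} → Graph n → Fin n → Fin n → Bool
adj G i j = lookup (lookup G i) j

Adj : ∀ {n} → Graph n → Fin n → Fin n → Set
Adj G i j = adj G i j ≡ true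

IsSimple : ∀ {n} → Graph n → Set
IsSimple G = (∀ i j → adj G i j ≡ adj G j i) × (∀ i → adj G i i ≡ false)

deg : ∀ {n} → Graph n → Fin n → ℕ
deg G i = sum (map (λ b → if b then 1 else 0) (lookup G i))

IsRegular : ∀ {n} → ℕ → Graph n → Set
IsRegular d G = ∀ i → deg G i ≡ d

data Reach {n} (G : Graph n) : Fin n → Fin n → Set where
  here : ∀ {x} → Reach G x x
  step : ∀ {x y z} → Adj G x y → Reach G y z → Reach G x z

Connected : ∀ {n} → Graph n → Set
Connected G = ∀ x y → Reach G x y

ΩS : ∀ {n} → ℕ → Graph n → Set
ΩS r G = IsSimple G × IsRegular (2 * r) G

ΩF : ∀ {n} → ℕ → Graph n → Set
ΩF r G = ΩS r G × Connected G

IsCompMax : ∀ {n} → Graph n → Fin n → Set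
IsCompMax G v = ∀ y → Reach G v y → y ≤ᶠ v

IsMaxNbr : ∀ {n} → Graph n → Fin n → Fin n → Set
IsMaxNbr G v w = Adj G v w × (∀ u → Adj G v u → u ≤ᶠ w)

csucc : ∀ {m} → Fin (suc m) → Fin (suc m)
csucc {m} i with toℕ i <? m
... | yes p = fsuc (fromℕ< p)
... | no _  = fzero

-- The data of the chaining construction on G with k = suc m components:
-- v i = highest vertex of the i-th component (components ordered by v),
-- v' i = highest neighbour of v i; and H is the result:
-- E(H) = (E(G) \ {v_i v_i'}) ∪ {v_i' v_{i+1}} (cyclic indices).
record ChainData {n} (G H : Graph n) (m : ℕ) : Set where
  field
    v  : Fin (suc m) → Fin n
    v' : Fin (suc m) → Fin n
    v-incr   : ∀ i j → i <ᶠ j → v i <ᶠ v j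
    v-max    : ∀ i → IsCompMax G (v i)
    v-all    : ∀ x → IsCompMax G x → ∃ λ i → v i ≡ x
    v'-max   : ∀ i → IsMaxNbr G (v i) (v' i)
  Deleted : Fin n → Fin n → Set
  Deleted x y = ∃ λ i → (x ≡ v i × y ≡ v' i) ⊎ (x ≡ v' i × y ≡ v i)
  Added : Fin n → Fin n → Set
  Added x y = ∃ λ i → (x ≡ v' i × y ≡ v (csucc i)) ⊎ (x ≡ v (csucc i) × y ≡ v' i)
  field
    edges : ∀ x y → Adj H x y ⇔ ((Adj G x y × ¬ Deleted x y) ⊎ Added x y)

Chain : ∀ {n} → Graph n → Graph n → Set
Chain G H = Σ ℕ (ChainData G H)

-- Each preimage GS (components with tops v 0 < … < v m, top neighbours v' j)
-- has a key (b, a) = (v' m, v 0): the added edge closing the cycle, an arc of G.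
-- G has n · 2r arcs, so it suffices that GS is determined by G and its key.
-- Indeed v m is the largest vertex, and going down, from the state
-- (v i, v' i, v (i+1)) the previous top neighbour v' (i-1) is the unique
-- neighbour of v i across a bridge of the partially undone graph, and v (i-1)
-- is the largest vertex on its side.  Uniqueness rests on the fact that an even
-- graph has no bridges, proved by a parity count in ℤ/2.  Knowing all v j and
-- v' j, GS is G with the added edges replaced by the deleted ones.
module Submission where

open import Defs
open import Data.Nat as ℕ using (ℕ; zero; suc; _≤_; _*_; _+_; z≤n; s≤s)
import Data.Nat.Properties as ℕP
open import Data.Fin using (Fin; toℕ; fromℕ; inject₁) renaming (zero to fzero; suc to fsuc)
import Data.Fin.Properties as FP
open import Data.Bool using (Bool; true; false; _∧_; _xor_; not; if_then_else_)
open import Data.Bool.Properties using (xor-∧-commutativeRing; ⇔→≡; xor-same; xor-identityʳ; not-distribˡ-xor; ∧-zeroʳ; ∧-identityʳ)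
open import Algebra.Bundles using (CommutativeRing)
open import Data.Vec as V using (Vec; []; _∷_; lookup)
import Data.Vec.Properties as VP
open import Data.Product using (Σ; ∃; _,_; proj₁; proj₂; _×_)
open import Data.Sum using (_⊎_; inj₁; inj₂)
open import Data.Empty using (⊥; ⊥-elim)
open import Relation.Nullary using (¬_; Dec; yes; no; does)
open import Relation.Nullary.Decidable using (¬¬-excluded-middle; decidable-stable; _×-dec_; _⊎-dec_)
open import Relation.Binary.PropositionalEquality
open import Relation.Binary.Definitions using (tri<; tri≈; tri>)
open import Function.Bundles using (Equivalence; mk⇔)
open import Function.Base using (case_of_)
open import Data.List as List using (List; length)
open import Data.List.Relation.Unary.All as All using (All; []; _∷_)
open import Data.List.Relation.Unary.AllPairs using ([]; _∷_)
open import Data.List.Relation.Unary.Unique.Propositional using (Unique)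
open import Data.List.Relation.Unary.Any using (here; there)
open import Data.List.Membership.Propositional using (_∈_)
open import Data.List.Membership.Propositional.Properties using (∈-map⁺; ∈-++⁺ˡ; ∈-++⁺ʳ)
import Data.List.Properties as LP
open import Relation.Binary.Construct.Closure.ReflexiveTransitive using (Star; ε; _◅_; _◅◅_; reverse)

open CommutativeRing xor-∧-commutativeRing using (+-commutativeMonoid; *-commutativeSemigroup; semiring)
open import Algebra.Properties.CommutativeMonoid.Sum +-commutativeMonoid
  using (∑-distrib-+; sum-cong-≗; sum-replicate-zero) renaming (sum to ⊕-sum)
open import Algebra.Properties.Semiring.Sum semiring using (*-distribˡ-sum)
open import Algebra.Properties.CommutativeSemigroup *-commutativeSemigroup using () renaming (x∙yz≈y∙xz to ∧-swap)

-- ⊕-sum: sums in ℤ/2 (Booleans under xor, with ∧ as product) of a family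
-- indexed by Fin n.

⊕-sum-δ : ∀ {n} (x : Fin n) → ⊕-sum (λ t → does (t FP.≟ x)) ≡ true
⊕-sum-δ {suc n} fzero = cong (true xor_) (sum-replicate-zero n)
⊕-sum-δ {suc n} (fsuc x) = ⊕-sum-δ x

-- A symmetric matrix with zero diagonal has even total sum (each off-diagonal
-- entry is counted twice).
⊕-sum-symmetric : ∀ {n} (f : Fin n → Fin n → Bool) → (∀ s t → f s t ≡ f t s) → (∀ s → f s s ≡ false) →
  ⊕-sum (λ s → ⊕-sum (f s)) ≡ false
⊕-sum-symmetric {zero} f sym-f diag-f = refl
⊕-sum-symmetric {suc n} f sym-f diag-f =
  begin
    (f₀₀ xor row₀) xor ⊕-sum (λ s → f (fsuc s) fzero xor rest s)
  ≡⟨ cong ((f₀₀ xor row₀) xor_) (∑-distrib-+ (λ s → f (fsuc s) fzero) rest) ⟩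
    (f₀₀ xor row₀) xor (col₀ xor ⊕-sum rest)
  ≡⟨ cong₂ (λ d r → (d xor row₀) xor (col₀ xor r)) (diag-f fzero) inner ⟩
    row₀ xor (col₀ xor false)
  ≡⟨ cong (row₀ xor_) (trans (xor-identityʳ col₀) (sum-cong-≗ (λ s → sym-f (fsuc s) fzero))) ⟩
    row₀ xor row₀
  ≡⟨ xor-same row₀ ⟩
    false
  ∎
  where
  open ≡-Reasoning
  f₀₀ row₀ col₀ : Bool
  f₀₀ = f fzero fzero
  row₀ = ⊕-sum (λ t → f fzero (fsuc t))
  col₀ = ⊕-sum (λ s → f (fsuc s) fzero)
  rest : Fin n → Bool
  rest s = ⊕-sum (λ t → f (fsuc s) (fsuc t))
  inner : ⊕-sum rest ≡ false
  inner = ⊕-sum-symmetric (λ s t → f (fsuc s) (fsuc t)) (λ s t → sym-f (fsuc s) (fsuc t)) (λ s → diag-f (fsuc s))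

parity : ℕ → Bool
parity zero = false
parity (suc k) = not (parity k)

parity-+ : ∀ a b → parity (a + b) ≡ parity a xor parity b
parity-+ zero b = refl
parity-+ (suc a) b = trans (cong not (parity-+ a b)) (not-distribˡ-xor (parity a) (parity b))

parity-double : ∀ r → parity (2 * r) ≡ false
parity-double r = begin
  parity (r + (r + 0))        ≡⟨ cong (λ k → parity (r + k)) (ℕP.+-identityʳ r) ⟩
  parity (r + r)              ≡⟨ parity-+ r r ⟩
  parity r xor parity r       ≡⟨ xor-same (parity r) ⟩
  false                       ∎
  where open ≡-Reasoning

parity-deg : ∀ {n} (G : Graph n) s → parity (deg G s) ≡ ⊕-sum (adj G s)
parity-deg G s = parity-row (lookup G s)
  where
  parity-row : ∀ {k} (row : Vec Bool k) → parity (V.sum (V.map (λ b → if b then 1 else 0) row)) ≡ ⊕-sum (lookup row)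
  parity-row [] = refl
  parity-row (true ∷ row) = cong not (parity-row row)
  parity-row (false ∷ row) = parity-row row

toReach : ∀ {n} {G : Graph n} {x y} → Star (Adj G) x y → Reach G x y
toReach ε = here
toReach (e ◅ w) = step e (toReach w)

SameEdge : ∀ {n} → Fin n → Fin n → Fin n → Fin n → Set
SameEdge p q s t = (s ≡ p × t ≡ q) ⊎ (s ≡ q × t ≡ p)

WithoutEdge : ∀ {n} → Graph n → Fin n → Fin n → Fin n → Fin n → Set
WithoutEdge G x w s t = Adj G s t × ¬ SameEdge x w s t

¬¬-decide-all : ∀ {n} (P : Fin n → Set) → ¬ ¬ (∀ i → Dec (P i))
¬¬-decide-all {zero} P k = k (λ ())
¬¬-decide-all {suc n} P k =
  ¬¬-decide-all (λ i → P (fsuc i)) λ dec-rest →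
  ¬¬-excluded-middle λ dec₀ →
  k (λ { fzero → dec₀ ; (fsuc i) → dec-rest i })

false≢true : false ≢ true
false≢true ()

≟-≢ : ∀ {n} {x y : Fin n} → x ≢ y → does (x FP.≟ y) ≡ false
≟-≢ {x = x} {y} x≢y with x FP.≟ y
... | yes x≡y = ⊥-elim (x≢y x≡y)
... | no _ = refl

-- If the set
-- W of vertices reachable from w in G ∖ {x,w} missed x, then summing the
-- adjacency matrix over W × W in ℤ/2 would give 0 by symmetry, but also
-- ∑_{s∈W} (deg s − [s = w]) ≡ 1, since w→x is the only edge leaving W.
module NoBridge {n} (G : Graph n) (simple : IsSimple G) (even : ∀ s → parity (deg G s) ≡ false)
                {x w : Fin n} (xw : Adj G x w) where

  private
    E : Fin n → Fin n → Set
    E = WithoutEdge G x w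

    module Handshake (reach? : ∀ s → Dec (Star E w s)) (x-unreached : ¬ Star E w x) where
      χ : Fin n → Bool
      χ s = does (reach? s)

      χ⇒reach : ∀ {s} → χ s ≡ true → Star E w s
      χ⇒reach {s} χs with reach? s
      ... | yes r = r
      ... | no _ = ⊥-elim (false≢true χs)

      reach⇒χ : ∀ {s} → Star E w s → χ s ≡ true
      reach⇒χ {s} r with reach? s
      ... | yes _ = refl
      ... | no ¬r = ⊥-elim (¬r r)

      χx : χ x ≡ false
      χx with reach? x
      ... | yes r = ⊥-elim (x-unreached r)
      ... | no _ = refl

      closed : ∀ {s t} → χ s ≡ true → ¬ SameEdge x w s t → χ t ∧ adj G s t ≡ adj G s t
      closed {s} {t} χs ¬xw with adj G s t in st
      ... | false = ∧-zeroʳ (χ t)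
      ... | true = trans (∧-identityʳ (χ t)) (reach⇒χ (χ⇒reach χs ◅◅ ((st , ¬xw) ◅ ε)))

      only-exit : ∀ {s t} → χ s ≡ true → ¬ (s ≡ w × t ≡ x) → ¬ SameEdge x w s t
      only-exit χs ¬wx (inj₁ (s≡x , _)) = false≢true (trans (sym χx) (subst (λ u → χ u ≡ true) s≡x χs))
      only-exit χs ¬wx (inj₂ wx) = ¬wx wx

      restricted-row : ∀ {s} → χ s ≡ true → ∀ t →
        χ t ∧ adj G s t ≡ adj G s t xor (does (s FP.≟ w) ∧ does (t FP.≟ x))
      restricted-row {s} χs t with s FP.≟ w | t FP.≟ x
      ... | yes refl | yes refl rewrite χx | trans (proj₁ simple w x) xw = refl
      ... | yes refl | no t≢x = trans (closed χs (only-exit χs (λ wx → t≢x (proj₂ wx)))) (sym (xor-identityʳ _))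
      ... | no s≢w | _ = trans (closed χs (only-exit χs (λ wx → s≢w (proj₁ wx)))) (sym (xor-identityʳ _))

      row-sum : ∀ s → ⊕-sum (λ t → χ s ∧ (χ t ∧ adj G s t)) ≡ does (s FP.≟ w)
      row-sum s with χ s in χs
      ... | false = trans (sum-replicate-zero n) (sym (≟-≢ s≢w))
        where
        s≢w : s ≢ w
        s≢w refl = false≢true (trans (sym χs) (reach⇒χ ε))
      ... | true = begin
        ⊕-sum (λ t → χ t ∧ adj G s t)
          ≡⟨ sum-cong-≗ (restricted-row χs) ⟩
        ⊕-sum (λ t → adj G s t xor (does (s FP.≟ w) ∧ does (t FP.≟ x)))
          ≡⟨ ∑-distrib-+ (adj G s) _ ⟩
        ⊕-sum (adj G s) xor ⊕-sum (λ t → does (s FP.≟ w) ∧ does (t FP.≟ x))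
          ≡⟨ cong₂ _xor_ (trans (sym (parity-deg G s)) (even s))
                         (sym (*-distribˡ-sum (does (s FP.≟ w)) (λ t → does (t FP.≟ x)))) ⟩
        does (s FP.≟ w) ∧ ⊕-sum (λ t → does (t FP.≟ x))
          ≡⟨ cong (does (s FP.≟ w) ∧_) (⊕-sum-δ x) ⟩
        does (s FP.≟ w) ∧ true
          ≡⟨ ∧-identityʳ _ ⟩
        does (s FP.≟ w)
          ∎
        where open ≡-Reasoning

    reached : (∀ s → Dec (Star E w s)) → ¬ ¬ Star E w x
    reached reach? x-unreached = false≢true (begin
      false                                                ≡⟨ sym (⊕-sum-symmetric W×W-adj W×W-sym W×W-diag) ⟩
      ⊕-sum (λ s → ⊕-sum (W×W-adj s))                       ≡⟨ sum-cong-≗ row-sum ⟩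
      ⊕-sum (λ s → does (s FP.≟ w))                         ≡⟨ ⊕-sum-δ w ⟩
      true                                                 ∎)
      where
      open ≡-Reasoning
      open Handshake reach? x-unreached
      W×W-adj : Fin n → Fin n → Bool
      W×W-adj s t = χ s ∧ (χ t ∧ adj G s t)
      W×W-sym : ∀ s t → W×W-adj s t ≡ W×W-adj t s
      W×W-sym s t = trans (cong (λ b → χ s ∧ (χ t ∧ b)) (proj₁ simple s t)) (∧-swap (χ s) (χ t) (adj G t s))
      W×W-diag : ∀ s → W×W-adj s s ≡ false
      W×W-diag s = trans (cong (λ b → χ s ∧ (χ s ∧ b)) (proj₂ simple s))
                         (trans (cong (χ s ∧_) (∧-zeroʳ (χ s))) (∧-zeroʳ (χ s)))

  no-bridge : ¬ ¬ Star (WithoutEdge G x w) w x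
  no-bridge x-unreached = ¬¬-decide-all (Star E w) (λ reach? → reached reach? x-unreached)

transfer : ∀ {n} {E E' : Fin n → Fin n → Set} (P : Fin n → Set) →
  (∀ {s t} → P s → E s t → P t × E' s t) → ∀ {x y} → P x → Star E x y → Star E' x y
transfer P step-ok p ε = ε
transfer P step-ok p (e ◅ w) = proj₂ (step-ok p e) ◅ transfer P step-ok (proj₁ (step-ok p e)) w

preserve : ∀ {n} {E : Fin n → Fin n → Set} (P : Fin n → Set) →
  (∀ {s t} → E s t → P s → P t) → ∀ {x y} → Star E x y → P x → P y
preserve P closed ε p = p
preserve P closed (e ◅ w) p = preserve P closed w (closed e p)

data CyclicView {m} : Fin (suc m) → Set where
  inner : (p : Fin m) → CyclicView (inject₁ p)
  final : CyclicView (fromℕ m)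

cyclicView : ∀ {m} (i : Fin (suc m)) → CyclicView i
cyclicView {zero} fzero = final
cyclicView {suc m} fzero = inner fzero
cyclicView {suc m} (fsuc i) with cyclicView i
... | inner p = inner (fsuc p)
... | final = final

csucc-inner : ∀ {m} (p : Fin m) → csucc (inject₁ p) ≡ fsuc p
csucc-inner {m} p with toℕ (inject₁ p) ℕ.<? m
... | yes lt = cong fsuc (FP.toℕ-injective (trans (FP.toℕ-fromℕ< lt) (FP.toℕ-inject₁ p)))
... | no ≮ = ⊥-elim (≮ (FP.inject₁ℕ< p))

csucc-final : ∀ m → csucc (fromℕ m) ≡ fzero
csucc-final m with toℕ (fromℕ m) ℕ.<? m
... | yes lt = ⊥-elim (ℕP.<-irrefl (FP.toℕ-fromℕ m) lt)
... | no _ = refl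

csucc-≢ : ∀ {m} (i : Fin (suc m)) → i ≢ fzero → csucc i ≢ i
csucc-≢ i = not-fixed (cyclicView i)
  where
  not-fixed : ∀ {m} {j : Fin (suc m)} → CyclicView j → j ≢ fzero → csucc j ≢ j
  not-fixed (inner p) _ eq =
    ℕP.1+n≢n (trans (cong toℕ (trans (sym (csucc-inner p)) eq)) (FP.toℕ-inject₁ p))
  not-fixed {m} final j≢0 eq = j≢0 (trans (sym eq) (csucc-final m))

SameEdge? : ∀ {n} (p q s t : Fin n) → Dec (SameEdge p q s t)
SameEdge? p q s t = ((s FP.≟ p) ×-dec (t FP.≟ q)) ⊎-dec ((s FP.≟ q) ×-dec (t FP.≟ p))

-- A state (x, x', y) of the reconstruction: the top x of the current component,
-- its largest neighbour x', and the top y of the next component (cyclically).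
State : ℕ → Set
State n = Fin n × Fin n × Fin n

-- Undoing a chaining H = h(GS) with key (b, a) = (v' m, v 0), one component at a
-- time from the top.  Everything here depends only on H, the key and the state,
-- which is why two preimages with the same key are reconstructed identically.
module Undo {n} (H : Graph n) (b a : Fin n) where

  -- At state (x, x', y): H without the closing edge {b,a} and the added edge
  -- {x',y}, with the deleted edge {x,x'} restored.
  StageEdge : State n → Fin n → Fin n → Set
  StageEdge (x , x' , y) s t = (Adj H s t × ¬ SameEdge b a s t × ¬ SameEdge x' y s t) ⊎ SameEdge x x' s t

  Cut : State n → Fin n → Fin n → Fin n → Set
  Cut σ c s t = StageEdge σ s t × ¬ SameEdge (proj₁ σ) c s t

  BridgeNbr : State n → Fin n → Set
  BridgeNbr σ c = StageEdge σ (proj₁ σ) c × ¬ Star (Cut σ c) c (proj₁ σ)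

  SideMax : State n → Fin n → Fin n → Set
  SideMax σ c z = ¬ ¬ Star (Cut σ c) c z × (∀ u → Star (Cut σ c) c u → toℕ u ≤ toℕ z)

  sideMax-≤ : ∀ {σ c z z'} → SideMax σ c z → SideMax σ c z' → toℕ z' ≤ toℕ z
  sideMax-≤ {z = z} {z'} (_ , below-z) (reach-z' , _) =
    decidable-stable (toℕ z' ℕ.≤? toℕ z) (λ z'≰z → reach-z' (λ walk → z'≰z (below-z z' walk)))

  sideMax-unique : ∀ {σ c z z'} → SideMax σ c z → SideMax σ c z' → z ≡ z'
  sideMax-unique max-z max-z' = FP.≤-antisym (sideMax-≤ max-z' max-z) (sideMax-≤ max-z max-z')

  Precedes : State n → State n → Set
  Precedes σ (z , c , x₀) = x₀ ≡ proj₁ σ × BridgeNbr σ c × SideMax σ c z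

keyOf : ∀ {n} {GS H : Graph n} {m} → ChainData GS H m → Fin n × Fin n
keyOf {m = m} D = ChainData.v' D (fromℕ m) , ChainData.v D fzero

-- The key is an edge of H: the added edge for the last index m, whose cyclic
-- successor is 0.
key-is-edge : ∀ {n} {GS H : Graph n} {m} (D : ChainData GS H m) → Adj H (proj₁ (keyOf D)) (proj₂ (keyOf D))
key-is-edge {m = m} D =
  Equivalence.from (ChainData.edges D _ _) (inj₂ (fromℕ m , inj₁ (refl , cong (ChainData.v D) (sym (csucc-final m)))))

module ChainFacts {n r} {GS H : Graph n} {m} (D : ChainData GS H m)
                  (simple : IsSimple GS) (regular : IsRegular (2 * r) GS) where
  open ChainData D public
  open Equivalence

  GS-sym : ∀ {s t} → Adj GS s t → Adj GS t s
  GS-sym {s} {t} e = trans (proj₁ simple t s) e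

  even-degrees : ∀ s → parity (deg GS s) ≡ false
  even-degrees s = trans (cong parity (regular s)) (parity-double r)

  vv' : ∀ i → Adj GS (v i) (v' i)
  vv' i = proj₁ (v'-max i)

  v≢v' : ∀ i → v i ≢ v' i
  v≢v' i eq = false≢true (trans (sym (proj₂ simple (v i))) (subst (Adj GS (v i)) (sym eq) (vv' i)))

  v-injective : ∀ {i j} → v i ≡ v j → i ≡ j
  v-injective {i} {j} eq with FP.<-cmp i j
  ... | tri< i<j _ _ = ⊥-elim (ℕP.<-irrefl (cong toℕ eq) (v-incr i j i<j))
  ... | tri≈ _ i≡j _ = i≡j
  ... | tri> _ _ j<i = ⊥-elim (ℕP.<-irrefl (cong toℕ (sym eq)) (v-incr j i j<i))

  v-monotone : ∀ {i j} → toℕ i ≤ toℕ j → toℕ (v i) ≤ toℕ (v j)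
  v-monotone {i} {j} i≤j with ℕP.m≤n⇒m<n∨m≡n i≤j
  ... | inj₁ i<j = ℕP.<⇒≤ (v-incr i j i<j)
  ... | inj₂ i≡j = ℕP.≤-reflexive (cong (λ k → toℕ (v k)) (FP.toℕ-injective i≡j))

  v-final-top : (T : Fin n) → (∀ u → toℕ u ≤ toℕ T) → v (fromℕ m) ≡ T
  v-final-top T T-top with v-all T (λ u _ → T-top u)
  ... | i , vi≡T = FP.≤-antisym (T-top (v (fromℕ m)))
                                (subst (λ u → toℕ u ≤ toℕ (v (fromℕ m))) vi≡T (v-monotone (FP.≤fromℕ i)))

  InComp : Fin n → Fin (suc m) → Set
  InComp s j = Star (Adj GS) s (v j)

  -- Two component tops joined by a walk are equal, so components are unique.
  InComp-unique : ∀ {s j k} → InComp s j → InComp s k → j ≡ k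
  InComp-unique {j = j} {k} s∈j s∈k = v-injective (FP.≤-antisym (v-max k (v j) (toReach (reverse GS-sym vk→vj)))
                                                     (v-max j (v k) (toReach vk→vj)))
    where
    vk→vj : Star (Adj GS) (v j) (v k)
    vk→vj = reverse GS-sym s∈j ◅◅ s∈k

  InComp-step : ∀ {s t j} → Adj GS s t → InComp s j → InComp t j
  InComp-step e s∈j = GS-sym e ◅ s∈j

  v∈ : ∀ j → InComp (v j) j
  v∈ j = ε

  v'∈ : ∀ j → InComp (v' j) j
  v'∈ j = GS-sym (vv' j) ◅ ε

  pair∈ : ∀ {p q s t j} → InComp s j → InComp t j → SameEdge p q s t → InComp p j × InComp q j
  pair∈ s∈j t∈j (inj₁ (refl , refl)) = s∈j , t∈j
  pair∈ s∈j t∈j (inj₂ (refl , refl)) = t∈j , s∈j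

  deleted∈ : ∀ {s t l} → SameEdge (v l) (v' l) s t → InComp s l
  deleted∈ {l = l} (inj₁ (refl , _)) = v∈ l
  deleted∈ {l = l} (inj₂ (refl , _)) = v'∈ l

  not-deleted : ∀ {s t j} → InComp s j → ¬ SameEdge (v j) (v' j) s t → ¬ Deleted s t
  not-deleted s∈j ¬vv' (l , del) with InComp-unique (deleted∈ del) s∈j
  ... | refl = ¬vv' del

  H-edge-kind : ∀ {s t} → Adj H s t → (Adj GS s t × ¬ Deleted s t) ⊎ Added s t
  H-edge-kind {s} {t} = to (edges s t)

  kept : ∀ {s t} → Adj GS s t → ¬ Deleted s t → Adj H s t
  kept {s} {t} e ¬del = from (edges s t) (inj₁ (e , ¬del))

  added : ∀ {s t} → Added s t → Adj H s t
  added {s} {t} add = from (edges s t) (inj₂ add)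

  deleted-edge : ∀ {s t} → Deleted s t → Adj GS s t
  deleted-edge (l , inj₁ (refl , refl)) = vv' l
  deleted-edge (l , inj₂ (refl , refl)) = GS-sym (vv' l)

  Deleted? : ∀ s t → Dec (Deleted s t)
  Deleted? s t = FP.any? (λ l → SameEdge? (v l) (v' l) s t)

  -- An added edge {v' l, v (l+1)} that is also an edge of GS lies inside one
  -- component, so l + 1 = l (there is a single component) and it was deleted.
  added-edge-of-GS : ∀ {s t} → Adj GS s t → Added s t → Deleted s t
  added-edge-of-GS st (l , inj₁ (s≡ , t≡)) = l , inj₂ (s≡ , trans t≡ (cong v l+1≡l))
    where
    l+1≡l : csucc l ≡ l
    l+1≡l = InComp-unique (subst (λ u → InComp u (csucc l)) (sym t≡) (v∈ (csucc l)))
                          (InComp-step st (subst (λ u → InComp u l) (sym s≡) (v'∈ l)))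
  added-edge-of-GS st (l , inj₂ (s≡ , t≡)) = l , inj₁ (trans s≡ (cong v l+1≡l) , t≡)
    where
    l+1≡l : csucc l ≡ l
    l+1≡l = InComp-unique (subst (λ u → InComp u (csucc l)) (sym s≡) (v∈ (csucc l)))
                          (InComp-step (GS-sym st) (subst (λ u → InComp u l) (sym t≡) (v'∈ l)))

  key : Fin n × Fin n
  key = keyOf D

  state : Fin (suc m) → State n
  state i = v i , v' i , v (csucc i)

  state-final : (T : Fin n) → (∀ u → toℕ u ≤ toℕ T) → state (fromℕ m) ≡ (T , key)
  state-final T T-top = cong₂ _,_ (v-final-top T T-top) (cong (v' (fromℕ m) ,_) (cong v (csucc-final m)))

  open Undo H (proj₁ key) (proj₂ key)

  module Stage (p : Fin m) where
    i q : Fin (suc m)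
    i = fsuc p
    q = inject₁ p

    x x' y c z : Fin n
    x = v i
    x' = v' i
    y = v (csucc i)
    c = v' q
    z = v q

    i≢q : i ≢ q
    i≢q eq = ℕP.1+n≢n (trans (cong toℕ eq) (FP.toℕ-inject₁ p))

    Low : Fin n → Set
    Low s = ∃ λ j → InComp s j × toℕ j ≤ toℕ p

    c-low : Low c
    c-low = q , v'∈ q , ℕP.≤-reflexive (FP.toℕ-inject₁ p)

    not-low : ∀ {s} → InComp s i → ¬ Low s
    not-low s∈i (j , s∈j , j≤p) = ℕP.1+n≰n (subst (λ k → toℕ k ≤ toℕ p) (InComp-unique s∈j s∈i) j≤p)

    low-forward : ∀ {s t} l → ¬ SameEdge x c s t → s ≡ v' l → t ≡ v (csucc l) → Low s → Low t
    low-forward {s} {t} l ¬xc s≡ t≡ (j , s∈j , j≤p) =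
      go (cyclicView l) (subst (λ k → toℕ k ≤ toℕ p) (sym l≡j) j≤p) s≡ t≡
      where
      l≡j : l ≡ j
      l≡j = InComp-unique (subst (λ u → InComp u l) (sym s≡) (v'∈ l)) s∈j
      go : ∀ {l} → CyclicView l → toℕ l ≤ toℕ p → s ≡ v' l → t ≡ v (csucc l) → Low t
      go final l≤p _ _ =
        ⊥-elim (ℕP.<⇒≱ (FP.toℕ<n p) (subst (_≤ toℕ p) (FP.toℕ-fromℕ m) l≤p))
      go (inner p') l≤p s≡ t≡ with suc (toℕ p') ℕ.≤? toℕ p
      ... | yes p'<p =
        fsuc p' , subst (λ u → InComp u (fsuc p')) (sym (trans t≡ (cong v (csucc-inner p')))) (v∈ (fsuc p')) , p'<p
      ... | no p'≮p with FP.toℕ-injective (ℕP.≤-antisym (subst (_≤ toℕ p) (FP.toℕ-inject₁ p') l≤p) (ℕP.≮⇒≥ p'≮p))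
      ...   | refl = ⊥-elim (¬xc (inj₂ (s≡ , trans t≡ (cong v (csucc-inner p)))))

    low-backward : ∀ {s t} l → ¬ SameEdge (proj₁ key) (proj₂ key) s t → s ≡ v (csucc l) → t ≡ v' l → Low s → Low t
    low-backward {s} {t} l ¬ba s≡ t≡ (j , s∈j , j≤p) =
      go (cyclicView l) (subst (λ k → toℕ k ≤ toℕ p) (sym l+1≡j) j≤p) s≡ t≡
      where
      l+1≡j : csucc l ≡ j
      l+1≡j = InComp-unique (subst (λ u → InComp u (csucc l)) (sym s≡) (v∈ (csucc l))) s∈j
      go : ∀ {l} → CyclicView l → toℕ (csucc l) ≤ toℕ p → s ≡ v (csucc l) → t ≡ v' l → Low t
      go final _ s≡ t≡ = ⊥-elim (¬ba (inj₂ (trans s≡ (cong v (csucc-final m)) , t≡)))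
      go (inner p') l+1≤p _ t≡ =
        inject₁ p' , subst (λ u → InComp u (inject₁ p')) (sym t≡) (v'∈ (inject₁ p')) ,
        subst (_≤ toℕ p) (sym (FP.toℕ-inject₁ p')) (ℕP.<⇒≤ (subst (λ k → toℕ k ≤ toℕ p) (csucc-inner p') l+1≤p))

    low-step : ∀ {s t} → Cut (state i) c s t → Low s → Low t
    low-step (inj₂ xx' , _) low = ⊥-elim (not-low (deleted∈ xx') low)
    low-step (inj₁ (st , ¬ba , _) , ¬xc) low@(j , s∈j , j≤p) with H-edge-kind st
    ... | inj₁ (st-GS , _) = j , InComp-step st-GS s∈j , j≤p
    ... | inj₂ (l , inj₁ (s≡ , t≡)) = low-forward l ¬xc s≡ t≡ low
    ... | inj₂ (l , inj₂ (s≡ , t≡)) = low-backward l ¬ba s≡ t≡ low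

    -- c is a bridge neighbour of x: {x, c} is the added edge v' q → v i, and it
    -- is the only edge leaving the low part.
    c-bridge : BridgeNbr (state i) c
    c-bridge = inj₁ (added (q , inj₂ (cong v (sym (csucc-inner p)) , refl)) , x≠b∨a , x≠x'∨y) ,
               λ walk → not-low (v∈ i) (preserve Low low-step walk c-low)
      where
      x≠b∨a : ¬ SameEdge (proj₁ key) (proj₂ key) x c
      x≠b∨a (inj₁ (x≡b , _)) =
        v≢v' i (trans x≡b (cong v' (InComp-unique (subst (λ u → InComp u (fromℕ m)) (sym x≡b) (v'∈ (fromℕ m))) (v∈ i))))
      x≠b∨a (inj₂ (x≡a , _)) with v-injective x≡a
      ... | ()
      x≠x'∨y : ¬ SameEdge x' y x c
      x≠x'∨y (inj₁ (x≡x' , _)) = v≢v' i x≡x'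
      x≠x'∨y (inj₂ (x≡y , _)) = csucc-≢ i (λ ()) (sym (v-injective x≡y))

    edge-in-i : ∀ {s t} → InComp s i → InComp t i → Adj GS s t → StageEdge (state i) s t
    edge-in-i {s} {t} s∈i t∈i st with SameEdge? x x' s t
    ... | yes xx' = inj₂ xx'
    ... | no ¬xx' = inj₁ (kept st (not-deleted s∈i ¬xx') , ¬ba , ¬x'y)
      where
      ¬ba : ¬ SameEdge (proj₁ key) (proj₂ key) s t
      ¬ba ba with InComp-unique (v∈ fzero) (proj₂ (pair∈ s∈i t∈i ba))
      ... | ()
      ¬x'y : ¬ SameEdge x' y s t
      ¬x'y x'y = csucc-≢ i (λ ()) (InComp-unique (v∈ (csucc i)) (proj₂ (pair∈ s∈i t∈i x'y)))

    -- A stage edge {x, w} with w ≠ c is an edge of GS: the only added edge at x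
    -- is {c, x}.
    x-edge-in-GS : ∀ {w} → w ≢ c → StageEdge (state i) x w → Adj GS x w
    x-edge-in-GS w≢c (inj₂ (inj₁ (_ , w≡x'))) = subst (Adj GS x) (sym w≡x') (vv' i)
    x-edge-in-GS w≢c (inj₂ (inj₂ (x≡x' , _))) = ⊥-elim (v≢v' i x≡x')
    x-edge-in-GS w≢c (inj₁ (xw-H , _)) with H-edge-kind xw-H
    ... | inj₁ (xw-GS , _) = xw-GS
    ... | inj₂ (l , inj₁ (x≡v'l , _)) with InComp-unique (v∈ i) (subst (λ u → InComp u l) (sym x≡v'l) (v'∈ l))
    ...   | refl = ⊥-elim (v≢v' i x≡v'l)
    x-edge-in-GS {w} w≢c (inj₁ (xw-H , _)) | inj₂ (l , inj₂ (x≡ , w≡)) =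
      ⊥-elim (from-below (cyclicView l) (v-injective (sym x≡)) w≡)
      where
      from-below : ∀ {l} → CyclicView l → csucc l ≡ i → w ≢ v' l
      from-below final l+1≡i with trans (sym (csucc-final m)) l+1≡i
      ... | ()
      from-below (inner p') l+1≡i with FP.suc-injective (trans (sym (csucc-inner p')) l+1≡i)
      ... | refl = w≢c

    -- Any other bridge neighbour w would give an edge {x, w} of GS; since GS has
    -- no bridges, w is joined to x inside component i avoiding {x, w}.
    bridgeNbr-unique : ∀ {w} → BridgeNbr (state i) w → w ≡ c
    bridgeNbr-unique {w} (xw , cut) with w FP.≟ c
    ... | yes w≡c = w≡c
    ... | no w≢c = ⊥-elim (NoBridge.no-bridge GS simple even-degrees xw-GS
                     (λ walk → cut (transfer (λ s → InComp s i) stay-in-i (InComp-step xw-GS (v∈ i)) walk)))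
      where
      xw-GS : Adj GS x w
      xw-GS = x-edge-in-GS w≢c xw
      stay-in-i : ∀ {s t} → InComp s i → WithoutEdge GS x w s t → InComp t i × Cut (state i) w s t
      stay-in-i s∈i (st , ¬xw) = t∈i , edge-in-i s∈i t∈i st , ¬xw
        where
        t∈i : InComp _ i
        t∈i = InComp-step st s∈i

    edge-in-q : ∀ {s t} → InComp s q → InComp t q → Adj GS s t → ¬ SameEdge z c s t → Cut (state i) c s t
    edge-in-q {s} {t} s∈q t∈q st ¬zc =
      inj₁ (kept st (not-deleted s∈q ¬zc) , ¬ba , ¬x'y) , ¬xc
      where
      ¬ba : ¬ SameEdge (proj₁ key) (proj₂ key) s t
      ¬ba ba = FP.fromℕ≢inject₁ (InComp-unique (v'∈ (fromℕ m)) (proj₁ (pair∈ s∈q t∈q ba)))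
      ¬x'y : ¬ SameEdge x' y s t
      ¬x'y x'y = i≢q (InComp-unique (v'∈ i) (proj₁ (pair∈ s∈q t∈q x'y)))
      ¬xc : ¬ SameEdge x c s t
      ¬xc xc = i≢q (InComp-unique (v∈ i) (proj₁ (pair∈ s∈q t∈q xc)))

    -- z is the top of c's side: it is reached from c since GS has no bridges,
    -- and everything reached from c is low, hence at most v q = z.
    z-sideMax : SideMax (state i) c z
    z-sideMax = reach-z , below-z
      where
      stay-in-q : ∀ {s t} → InComp s q → WithoutEdge GS z c s t → InComp t q × Cut (state i) c s t
      stay-in-q s∈q (st , ¬zc) = t∈q , edge-in-q s∈q t∈q st ¬zc
        where
        t∈q : InComp _ q
        t∈q = InComp-step st s∈q
      reach-z : ¬ ¬ Star (Cut (state i) c) c z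
      reach-z no-walk = NoBridge.no-bridge GS simple even-degrees (vv' q)
                          (λ walk → no-walk (transfer (λ s → InComp s q) stay-in-q (v'∈ q) walk))
      below-z : ∀ u → Star (Cut (state i) c) c u → toℕ u ≤ toℕ z
      below-z u walk with preserve Low low-step walk c-low
      ... | j , u∈j , j≤p = ℕP.≤-trans (v-max j u (toReach (reverse GS-sym u∈j)))
                                       (v-monotone (subst (toℕ j ≤_) (sym (FP.toℕ-inject₁ p)) j≤p))

    precedes : Precedes (state i) (state q)
    precedes = cong v (csucc-inner p) , c-bridge , z-sideMax

    precedes-unique : ∀ {σ} → Precedes (state i) σ → σ ≡ state q
    precedes-unique {z' , c' , x₀} (x₀≡x , bridge , side) with bridgeNbr-unique bridge
    ... | refl with sideMax-unique side z-sideMax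
    ...   | refl = cong (λ u → z , c , u) (trans x₀≡x (sym (cong v (csucc-inner p))))

module Compare {n r} {GS₁ GS₂ H : Graph n} {m₁ m₂}
               (D₁ : ChainData GS₁ H m₁) (simple₁ : IsSimple GS₁) (regular₁ : IsRegular (2 * r) GS₁)
               (D₂ : ChainData GS₂ H m₂) (simple₂ : IsSimple GS₂) (regular₂ : IsRegular (2 * r) GS₂)
               (same-key : keyOf D₁ ≡ keyOf D₂) where
  module C₁ = ChainFacts {r = r} D₁ simple₁ regular₁
  module C₂ = ChainFacts {r = r} D₂ simple₂ regular₂

  precedes₁₂ : ∀ {σ σ'} → Undo.Precedes H (proj₁ C₁.key) (proj₂ C₁.key) σ σ' →
                          Undo.Precedes H (proj₁ C₂.key) (proj₂ C₂.key) σ σ'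
  precedes₁₂ {σ} {σ'} = subst (λ k → Undo.Precedes H (proj₁ k) (proj₂ k) σ σ') same-key

  AgreeUpTo : ℕ → Set
  AgreeUpTo k = ∀ j₁ j₂ → toℕ j₁ ≡ toℕ j₂ → toℕ j₁ ≤ k → C₁.state j₁ ≡ C₂.state j₂

  descend : ∀ k (i₁ : Fin (suc m₁)) (i₂ : Fin (suc m₂)) → toℕ i₁ ≡ k → C₁.state i₁ ≡ C₂.state i₂ →
            toℕ i₁ ≡ toℕ i₂ × AgreeUpTo k
  descend .0 fzero fzero refl agree = refl , at-zero
    where
    at-zero : AgreeUpTo 0
    at-zero fzero fzero _ _ = agree
    at-zero fzero (fsuc _) () _
  descend k fzero (fsuc p₂) _ agree with C₂.v-injective (trans (sym (cong proj₁ agree)) (cong proj₂ same-key))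
  ... | ()
  descend k (fsuc p₁) fzero _ agree with C₁.v-injective (trans (cong proj₁ agree) (sym (cong proj₂ same-key)))
  ... | ()
  descend (suc k) (fsuc p₁) (fsuc p₂) i₁≡k agree = cong suc p₁≡p₂ , agree-up-to
    where
    module S₁ = C₁.Stage p₁
    module S₂ = C₂.Stage p₂
    agree-below : C₁.state S₁.q ≡ C₂.state S₂.q
    agree-below = S₂.precedes-unique (subst (λ σ → Undo.Precedes H (proj₁ C₂.key) (proj₂ C₂.key) σ (C₁.state S₁.q)) agree
                                            (precedes₁₂ S₁.precedes))
    below : toℕ S₁.q ≡ toℕ S₂.q × AgreeUpTo k
    below = descend k S₁.q S₂.q (trans (FP.toℕ-inject₁ p₁) (ℕP.suc-injective i₁≡k)) agree-below
    p₁≡p₂ : toℕ p₁ ≡ toℕ p₂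
    p₁≡p₂ = trans (sym (FP.toℕ-inject₁ p₁)) (trans (proj₁ below) (FP.toℕ-inject₁ p₂))
    agree-up-to : AgreeUpTo (suc k)
    agree-up-to j₁ j₂ j₁≡j₂ j₁≤k+1 with ℕP.m≤n⇒m<n∨m≡n j₁≤k+1
    ... | inj₁ j₁≤k = proj₂ below j₁ j₂ j₁≡j₂ (ℕP.≤-pred j₁≤k)
    ... | inj₂ j₁≡k+1 with FP.toℕ-injective (trans j₁≡k+1 (sym i₁≡k))
                         | FP.toℕ-injective (trans (sym j₁≡j₂) (trans j₁≡k+1 (trans (sym i₁≡k) (cong suc p₁≡p₂))))
    ...   | refl | refl = agree

  all-agree : (T : Fin n) → (∀ u → toℕ u ≤ toℕ T) →
              m₁ ≡ m₂ × (∀ j₁ j₂ → toℕ j₁ ≡ toℕ j₂ → C₁.state j₁ ≡ C₂.state j₂)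
  all-agree T T-top = m₁≡m₂ , λ j₁ j₂ j₁≡j₂ → proj₂ from-top j₁ j₂ j₁≡j₂ (FP.toℕ≤pred[n] j₁)
    where
    top-agree : C₁.state (fromℕ m₁) ≡ C₂.state (fromℕ m₂)
    top-agree = trans (C₁.state-final T T-top) (trans (cong (T ,_) same-key) (sym (C₂.state-final T T-top)))
    from-top : toℕ (fromℕ m₁) ≡ toℕ (fromℕ m₂) × AgreeUpTo m₁
    from-top = descend m₁ (fromℕ m₁) (fromℕ m₂) (FP.toℕ-fromℕ m₁) top-agree
    m₁≡m₂ : m₁ ≡ m₂
    m₁≡m₂ = trans (sym (FP.toℕ-fromℕ m₁)) (trans (proj₁ from-top) (FP.toℕ-fromℕ m₂))

-- Once the tops and top neighbours are known, GS is recovered from H: its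
-- edges are the deleted edges together with the non-added edges of H.
module Recover {n r} {GS₁ GS₂ H : Graph n} {m}
               (D₁ : ChainData GS₁ H m) (simple₁ : IsSimple GS₁) (regular₁ : IsRegular (2 * r) GS₁)
               (D₂ : ChainData GS₂ H m) (simple₂ : IsSimple GS₂) (regular₂ : IsRegular (2 * r) GS₂)
               (same-state : ∀ j → ChainFacts.state {r = r} D₁ simple₁ regular₁ j ≡ ChainFacts.state {r = r} D₂ simple₂ regular₂ j) where
  module C₁ = ChainFacts {r = r} D₁ simple₁ regular₁
  module C₂ = ChainFacts {r = r} D₂ simple₂ regular₂

  deleted₁₂ : ∀ {s t} → C₁.Deleted s t → C₂.Deleted s t
  deleted₁₂ {s} {t} (l , e) =
    l , subst₂ (λ u u' → SameEdge u u' s t) (cong proj₁ (same-state l)) (cong (λ σ → proj₁ (proj₂ σ)) (same-state l)) e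

  added₂₁ : ∀ {s t} → C₂.Added s t → C₁.Added s t
  added₂₁ {s} {t} (l , e) =
    l , subst₂ (λ u u' → SameEdge u u' s t) (sym (cong (λ σ → proj₁ (proj₂ σ)) (same-state l)))
                                            (sym (cong (λ σ → proj₂ (proj₂ σ)) (same-state l))) e

  edge₁₂ : ∀ {s t} → Adj GS₁ s t → Adj GS₂ s t
  edge₁₂ {s} {t} st with C₁.Deleted? s t
  ... | yes del = C₂.deleted-edge (deleted₁₂ del)
  ... | no ¬del with C₂.H-edge-kind (C₁.kept st ¬del)
  ...   | inj₁ (st₂ , _) = st₂
  ...   | inj₂ add = ⊥-elim (¬del (C₁.added-edge-of-GS st (added₂₁ add)))

graph-ext : ∀ {n} {G G' : Graph n} → (∀ s t → adj G s t ≡ adj G' s t) → G ≡ G'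
graph-ext same = vec-ext (λ s → vec-ext (same s))
  where
  vec-ext : ∀ {A : Set} {k} {xs ys : Vec A k} → (∀ i → lookup xs i ≡ lookup ys i) → xs ≡ ys
  vec-ext {xs = xs} {ys} same-entries =
    trans (sym (VP.tabulate∘lookup xs)) (trans (VP.tabulate-cong same-entries) (VP.tabulate∘lookup ys))

chain-key-injective : ∀ {n r} {H GS₁ GS₂ : Graph n} → ΩS r GS₁ → ΩS r GS₂ →
  (c₁ : Chain GS₁ H) (c₂ : Chain GS₂ H) → keyOf (proj₂ c₁) ≡ keyOf (proj₂ c₂) → GS₁ ≡ GS₂
chain-key-injective {zero} _ _ (_ , D₁) _ _ with ChainData.v D₁ fzero
... | ()
chain-key-injective {suc n'} {r} (simple₁ , regular₁) (simple₂ , regular₂) (m₁ , D₁) (m₂ , D₂) same-key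
  with Compare.all-agree {r = r} D₁ simple₁ regular₁ D₂ simple₂ regular₂ same-key (fromℕ n') FP.≤fromℕ
... | refl , agree = graph-ext λ s t → ⇔→≡ (mk⇔ R₁₂.edge₁₂ R₂₁.edge₁₂)
  where
  module R₁₂ = Recover {r = r} D₁ simple₁ regular₁ D₂ simple₂ regular₂ (λ j → agree j j refl)
  module R₂₁ = Recover {r = r} D₂ simple₂ regular₂ D₁ simple₁ regular₁ (λ j → sym (agree j j refl))

module _ {A : Set} where
  remove : ∀ {x : A} (ys : List A) → x ∈ ys → List A
  remove (_ List.∷ ys) (here _) = ys
  remove (y List.∷ ys) (there x∈ys) = y List.∷ remove ys x∈ys

  remove-length : ∀ {x : A} (ys : List A) (x∈ys : x ∈ ys) → suc (length (remove ys x∈ys)) ≡ length ys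
  remove-length (_ List.∷ ys) (here _) = refl
  remove-length (_ List.∷ ys) (there x∈ys) = cong suc (remove-length ys x∈ys)

  remove-∈ : ∀ {x z : A} (ys : List A) (x∈ys : x ∈ ys) → z ∈ ys → z ≢ x → z ∈ remove ys x∈ys
  remove-∈ (_ List.∷ ys) (here refl) (here refl) z≢x = ⊥-elim (z≢x refl)
  remove-∈ (_ List.∷ ys) (here refl) (there z∈ys) z≢x = z∈ys
  remove-∈ (_ List.∷ ys) (there x∈ys) (here refl) z≢x = here refl
  remove-∈ (_ List.∷ ys) (there x∈ys) (there z∈ys) z≢x = there (remove-∈ ys x∈ys z∈ys z≢x)

  unique-⊆-length : ∀ {xs ys : List A} → Unique xs → (∀ {z} → z ∈ xs → z ∈ ys) → length xs ≤ length ys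
  unique-⊆-length {List.[]} [] _ = z≤n
  unique-⊆-length {x List.∷ xs} {ys} (x≢xs ∷ unique) xs⊆ys =
    subst (suc (length xs) ≤_) (remove-length ys x∈ys)
      (s≤s (unique-⊆-length unique λ z∈xs →
              remove-∈ ys x∈ys (xs⊆ys (there z∈xs)) (λ z≡x → All.lookup x≢xs z∈xs (sym z≡x))))
    where
    x∈ys : x ∈ ys
    x∈ys = xs⊆ys (here refl)

module Labelling {A B : Set} {P : A → Set} (label : ∀ {x} → P x → B)
                 (label-injective : ∀ {x y} (px : P x) (py : P y) → label px ≡ label py → x ≡ y) where

  labels : ∀ {xs} → All P xs → List B
  labels = All.reduce label

  labels-length : ∀ {xs} (ps : All P xs) → length (labels ps) ≡ length xs
  labels-length [] = refl
  labels-length (_ ∷ ps) = cong suc (labels-length ps)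

  labels-∈ : ∀ {xs} (ps : All P xs) {z} → z ∈ labels ps → ∃ λ x → Σ (P x) λ px → z ≡ label px
  labels-∈ (px ∷ _) (here refl) = _ , px , refl
  labels-∈ (_ ∷ ps) (there z∈) = labels-∈ ps z∈

  distinct-labels : ∀ {x xs} (px : P x) → All (x ≢_) xs → (ps : All P xs) → All (label px ≢_) (labels ps)
  distinct-labels px [] [] = []
  distinct-labels px (x≢y ∷ x≢ys) (py ∷ ps) = (λ eq → x≢y (label-injective px py eq)) ∷ distinct-labels px x≢ys ps

  labels-unique : ∀ {xs} → Unique xs → (ps : All P xs) → Unique (labels ps)
  labels-unique [] [] = []
  labels-unique (x≢xs ∷ unique) (px ∷ ps) = distinct-labels px x≢xs ps ∷ labels-unique unique ps

  injection-length : ∀ {xs ys} → Unique xs → All P xs → (∀ {x} (px : P x) → label px ∈ ys) → length xs ≤ length ys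
  injection-length {xs} unique ps labelled =
    subst (_≤ _) (labels-length ps)
      (unique-⊆-length (labels-unique unique ps) λ z∈ → case labels-∈ ps z∈ of λ { (_ , px , refl) → labelled px })

trues : ∀ {k} → Vec Bool k → List (Fin k)
trues [] = List.[]
trues (true ∷ bs) = fzero List.∷ List.map fsuc (trues bs)
trues (false ∷ bs) = List.map fsuc (trues bs)

trues-length : ∀ {k} (bs : Vec Bool k) → length (trues bs) ≡ V.sum (V.map (λ b → if b then 1 else 0) bs)
trues-length [] = refl
trues-length (true ∷ bs) = cong suc (trans (LP.length-map fsuc (trues bs)) (trues-length bs))
trues-length (false ∷ bs) = trans (LP.length-map fsuc (trues bs)) (trues-length bs)

trues-∈ : ∀ {k} (bs : Vec Bool k) j → lookup bs j ≡ true → j ∈ trues bs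
trues-∈ (true ∷ bs) fzero _ = here refl
trues-∈ (true ∷ bs) (fsuc j) bj = there (∈-map⁺ fsuc (trues-∈ bs j bj))
trues-∈ (false ∷ bs) (fsuc j) bj = ∈-map⁺ fsuc (trues-∈ bs j bj)

in-first-row : ∀ {k n} → Fin n → Fin (suc k) × Fin n
in-first-row t = fzero , t

next-row : ∀ {k n} → Fin k × Fin n → Fin (suc k) × Fin n
next-row (s , t) = fsuc s , t

arcs : ∀ {k n} → Vec (Vec Bool n) k → List (Fin k × Fin n)
arcs [] = List.[]
arcs (row ∷ rows) = List.map in-first-row (trues row) List.++ List.map next-row (arcs rows)

arcs-length : ∀ {k n} (rows : Vec (Vec Bool n) k) d →
  (∀ s → V.sum (V.map (λ b → if b then 1 else 0) (lookup rows s)) ≡ d) → length (arcs rows) ≡ k * d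
arcs-length {suc k} {n} (row ∷ rows) d row-sums = begin
  length (first List.++ rest)             ≡⟨ LP.length-++ first ⟩
  length first + length rest              ≡⟨ cong₂ _+_ (trans (LP.length-map in-first-row (trues row)) (trues-length row))
                                                       (LP.length-map next-row (arcs rows)) ⟩
  V.sum (V.map (λ b → if b then 1 else 0) row) + length (arcs rows)
                                          ≡⟨ cong₂ _+_ (row-sums fzero) (arcs-length rows d (λ s → row-sums (fsuc s))) ⟩
  d + k * d                               ∎
  where
  open ≡-Reasoning
  first rest : List (Fin (suc k) × Fin n)
  first = List.map in-first-row (trues row)
  rest = List.map next-row (arcs rows)
arcs-length [] d _ = refl

arcs-∈ : ∀ {k n} (rows : Vec (Vec Bool n) k) s t → lookup (lookup rows s) t ≡ true → (s , t) ∈ arcs rows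
arcs-∈ (row ∷ rows) fzero t st = ∈-++⁺ˡ (∈-map⁺ in-first-row (trues-∈ row t st))
arcs-∈ (row ∷ rows) (fsuc s) t st = ∈-++⁺ʳ (List.map in-first-row (trues row)) (∈-map⁺ next-row (arcs-∈ rows s t st))

lemma4p2 : (r n : ℕ) → 2 ≤ r → 8 ≤ n → 2 * r + 1 ≤ n →
    (G : Graph n) → ΩF r G →
    (Gs : List (Graph n)) → Unique Gs → All (λ GS → ΩS r GS × Chain GS G) Gs →
    length Gs ≤ 2 * r * n
lemma4p2 r n _ _ _ G ((_ , regular) , _) Gs unique preimages = begin
  length Gs         ≤⟨ injection-length unique preimages (λ (_ , _ , D) → arcs-∈ G _ _ (key-is-edge D)) ⟩
  length (arcs G)   ≡⟨ arcs-length G (2 * r) regular ⟩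
  n * (2 * r)       ≡⟨ ℕP.*-comm n (2 * r) ⟩
  2 * r * n         ∎
  where
  open ℕP.≤-Reasoning
  open Labelling {P = λ GS → ΩS r GS × Chain GS G} (λ preimage → keyOf (proj₂ (proj₂ preimage)))
                 (λ (Ω₁ , c₁) (Ω₂ , c₂) → chain-key-injective {r = r} Ω₁ Ω₂ c₁ c₂)
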